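{- Let $0<|q|<1$, $a,v\in\mathbb{C}$ and $u\in\mathbb{C}\setminus\{0\}$. Then $$\mathrm{T}(yD_{q}|u)\big\{\mathrm{e}_{q}(ax,v)\big\}=\sum_{k=0}^{\infty}(uv)^{\binom{k}{2}}\frac{(ay)^{k}}{(q;q)_{k}}\,\mathrm{e}_{q}(av^{k}x,v).$$
   Context: $(a;q)_n=\prod_{k=0}^{n-1}(1-aq^k)$. The deformed $q$-exponential is $\mathrm{e}_{q}(z,u)=\sum_{n=0}^{\infty}u^{\binom{n}{2}}\frac{z^{n}}{(q;q)_{n}}$ (with $0^0=1$, so $\mathrm{e}_q(z,0)=1+\frac{z}{1-q}$). The $q$-differential operator in $x$ is $D_qf(x)=\frac{f(x)-f(qx)}{x}$ (so $D_qx^k=(1-q^k)x^{k-1}$), and $\mathrm{T}(yD_{q}|u)=\sum_{n=0}^{\infty}u^{\binom{n}{2}}\frac{y^{n}D_{q}^{n}}{(q;q)_{n}}$ acts on power series in $x$. The identity is understood as an identity of formal power series in $x$ and $y$. -}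

module Defs where

open import Level using (Level)
open import Data.Nat using (ℕ; zero; suc; _+_)
open import Algebra.Bundles using (CommutativeRing)

C2 : ℕ → ℕ
C2 zero = zero
C2 (suc n) = C2 n + n

-- Everything is over an arbitrary commutative ring R (generalising ℂ).
-- Formal power series in x:        ℕ → Carrier   (f m = coefficient of x^m)
-- Formal power series in x and y:  ℕ → ℕ → Carrier (F n m = coefficient of y^n x^m)
module QSeries {c ℓ : Level} (R : CommutativeRing c ℓ) where
  open CommutativeRing R

  -- x ^ n with x ^ 0 = 1 (so 0^0 = 1)
  pow : Carrier → ℕ → Carrier
  pow x zero = 1#
  pow x (suc n) = x * pow x n

  qPoch : Carrier → ℕ → Carrier
  qPoch q zero = 1#
  qPoch q (suc n) = qPoch q n * (1# - pow q (suc n))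

  Series1 : Set c
  Series1 = ℕ → Carrier

  Series2 : Set c
  Series2 = ℕ → ℕ → Carrier

  -- inv n plays the role of 1/(q;q)_n (hypothesised to be its inverse).
  -- e_q(a x, v) = Σ_j v^{C(j,2)} (a x)^j / (q;q)_j  as a series in x
  eq : (q : Carrier) (inv : ℕ → Carrier) → Carrier → Carrier → Series1
  eq q inv a v j = pow v (C2 j) * pow a j * inv j

  -- D_q f(x) = (f(x) - f(qx))/x on coefficients:  x^{m+1} ↦ (1 - q^{m+1}) x^m
  Dq : (q : Carrier) → Series1 → Series1
  Dq q f m = (1# - pow q (suc m)) * f (suc m)

  Dq^ : (q : Carrier) → ℕ → Series1 → Series1
  Dq^ q zero f = f
  Dq^ q (suc n) f = Dq q (Dq^ q n f)

  -- T(y D_q | u) f = Σ_n u^{C(n,2)} y^n D_q^n f / (q;q)_n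
  T : (q : Carrier) (inv : ℕ → Carrier) → Carrier → Series1 → Series2
  T q inv u f n m = pow u (C2 n) * inv n * Dq^ q n f m

  -- Σ_k c_k y^k g_k(x)  for scalars c_k and x-series g_k
  ySum : (ℕ → Carrier) → (ℕ → Series1) → Series2
  ySum cf g n m = cf n * g n m

  _≋_ : Series2 → Series2 → Set ℓ
  F ≋ G = ∀ n m → F n m ≈ G n m

{-# OPTIONS --safe #-}
-- Coefficientwise, both sides are products of monomials: D_q^n lowers x^(n+m) to x^m with the factor
-- (q^(m+1);q)_n = (q;q)_(n+m) / (q;q)_m, which turns 1/(q;q)_(n+m) into 1/(q;q)_m, and the deformation
-- exponent splits as C(n+m,2) = C(n,2) + C(m,2) + n m, the cross term n m being absorbed into (a v^n)^m.
module Submission where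

open import Defs
open import Level using (Level)
open import Data.Nat using (ℕ)
open import Relation.Nullary using (¬_)
open import Algebra.Bundles using (CommutativeRing)

import Data.Nat as ℕ
open import Data.Nat.Tactic.RingSolver using (solve-∀)
import Data.Nat.Properties as ℕ
open import Relation.Binary.PropositionalEquality as ≡ using (_≡_)
import Relation.Binary.Reasoning.Setoid as SetoidReasoning
import Algebra.Properties.CommutativeSemiring.Exp as Exp
import Algebra.Properties.CommutativeSemigroup as CommutativeSemigroupProperties
import Algebra.Solver.CommutativeMonoid as CommutativeMonoidSolver

C2-+ : ∀ n m → C2 (n ℕ.+ m) ≡ C2 n ℕ.+ C2 m ℕ.+ n ℕ.* m
C2-+ ℕ.zero    m = ≡.sym (ℕ.+-identityʳ (C2 m))
C2-+ (ℕ.suc n) m = ≡.trans (≡.cong (ℕ._+ (n ℕ.+ m)) (C2-+ n m)) (regroup (C2 n) (C2 m) n m)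
  where
  regroup : ∀ a b n m → a ℕ.+ b ℕ.+ n ℕ.* m ℕ.+ (n ℕ.+ m) ≡ a ℕ.+ n ℕ.+ b ℕ.+ ℕ.suc n ℕ.* m
  regroup = solve-∀

module _ {c ℓ : Level} (R : CommutativeRing c ℓ) where
  open CommutativeRing R
  open QSeries R
  open Exp commutativeSemiring using (_^_; ^-homo-*; ^-assocʳ; ^-distrib-*)
  open CommutativeSemigroupProperties *-commutativeSemigroup using (x∙yz≈y∙xz)
  open CommutativeMonoidSolver *-commutativeMonoid using (solve; _⊕_; _⊜_)
  open SetoidReasoning setoid

  pow≡^ : ∀ x n → pow x n ≡ x ^ n
  pow≡^ x ℕ.zero    = ≡.refl
  pow≡^ x (ℕ.suc n) = ≡.cong (x *_) (pow≡^ x n)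

  pow-homo-* : ∀ x m n → pow x (m ℕ.+ n) ≈ pow x m * pow x n
  pow-homo-* x m n rewrite pow≡^ x (m ℕ.+ n) | pow≡^ x m | pow≡^ x n = ^-homo-* x m n

  pow-assocʳ : ∀ x m n → pow (pow x m) n ≈ pow x (m ℕ.* n)
  pow-assocʳ x m n rewrite pow≡^ (pow x m) n | pow≡^ x m | pow≡^ x (m ℕ.* n) = ^-assocʳ x m n

  pow-distrib-* : ∀ x y n → pow (x * y) n ≈ pow x n * pow y n
  pow-distrib-* x y n rewrite pow≡^ (x * y) n | pow≡^ x n | pow≡^ y n = ^-distrib-* x y n

  *-inverseʳ-unique : ∀ {x a b} → x * a ≈ 1# → x * b ≈ 1# → b ≈ a
  *-inverseʳ-unique {x} {a} {b} xa≈1 xb≈1 = begin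
    b           ≈⟨ *-identityˡ b ⟨
    1# * b      ≈⟨ *-congʳ xa≈1 ⟨
    x * a * b   ≈⟨ solve 3 (λ x a b → (x ⊕ a) ⊕ b ⊜ (x ⊕ b) ⊕ a) refl x a b ⟩
    x * b * a   ≈⟨ *-congʳ xb≈1 ⟩
    1# * a      ≈⟨ *-identityˡ a ⟩
    a           ∎

  pow-C2-+ : ∀ v n m → pow v (C2 (n ℕ.+ m)) ≈ pow v (C2 n) * pow v (C2 m) * pow (pow v n) m
  pow-C2-+ v n m = begin
    pow v (C2 (n ℕ.+ m))                              ≡⟨ ≡.cong (pow v) (C2-+ n m) ⟩
    pow v (C2 n ℕ.+ C2 m ℕ.+ n ℕ.* m)                 ≈⟨ pow-homo-* v (C2 n ℕ.+ C2 m) (n ℕ.* m) ⟩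
    pow v (C2 n ℕ.+ C2 m) * pow v (n ℕ.* m)           ≈⟨ *-cong (pow-homo-* v (C2 n) (C2 m)) (sym (pow-assocʳ v n m)) ⟩
    pow v (C2 n) * pow v (C2 m) * pow (pow v n) m     ∎

  eq-monomial-+ : ∀ a v n m →
    pow v (C2 (n ℕ.+ m)) * pow a (n ℕ.+ m) ≈ pow v (C2 n) * pow a n * (pow v (C2 m) * pow (a * pow v n) m)
  eq-monomial-+ a v n m = begin
    pow v (C2 (n ℕ.+ m)) * pow a (n ℕ.+ m)
      ≈⟨ *-cong (pow-C2-+ v n m) (pow-homo-* a n m) ⟩
    pow v (C2 n) * pow v (C2 m) * pow (pow v n) m * (pow a n * pow a m)
      ≈⟨ solve 5 (λ v₁ v₂ w a₁ a₂ → ((v₁ ⊕ v₂) ⊕ w) ⊕ (a₁ ⊕ a₂) ⊜ (v₁ ⊕ a₁) ⊕ (v₂ ⊕ (a₂ ⊕ w))) refl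
                 (pow v (C2 n)) (pow v (C2 m)) (pow (pow v n) m) (pow a n) (pow a m) ⟩
    pow v (C2 n) * pow a n * (pow v (C2 m) * (pow a m * pow (pow v n) m))
      ≈⟨ *-congˡ (*-congˡ (pow-distrib-* a (pow v n) m)) ⟨
    pow v (C2 n) * pow a n * (pow v (C2 m) * pow (a * pow v n) m)
      ∎

  module _ (q : Carrier) where

    qPochFrom : ℕ → ℕ → Carrier
    qPochFrom m ℕ.zero    = 1#
    qPochFrom m (ℕ.suc n) = (1# - pow q (ℕ.suc m)) * qPochFrom (ℕ.suc m) n

    Dq^-coeff : ∀ f n m → Dq^ q n f m ≈ qPochFrom m n * f (n ℕ.+ m)
    Dq^-coeff f ℕ.zero    m = sym (*-identityˡ (f m))
    Dq^-coeff f (ℕ.suc n) m = begin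
      (1# - pow q (ℕ.suc m)) * Dq^ q n f (ℕ.suc m)
        ≈⟨ *-congˡ (Dq^-coeff f n (ℕ.suc m)) ⟩
      (1# - pow q (ℕ.suc m)) * (qPochFrom (ℕ.suc m) n * f (n ℕ.+ ℕ.suc m))
        ≈⟨ *-assoc _ _ _ ⟨
      qPochFrom m (ℕ.suc n) * f (n ℕ.+ ℕ.suc m)
        ≡⟨ ≡.cong (λ k → qPochFrom m (ℕ.suc n) * f k) (ℕ.+-suc n m) ⟩
      qPochFrom m (ℕ.suc n) * f (ℕ.suc n ℕ.+ m)
        ∎

    qPoch-+ : ∀ n m → qPoch q (n ℕ.+ m) ≈ qPoch q m * qPochFrom m n
    qPoch-+ ℕ.zero    m = sym (*-identityʳ (qPoch q m))
    qPoch-+ (ℕ.suc n) m = begin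
      qPoch q (ℕ.suc n ℕ.+ m)                                 ≡⟨ ≡.cong (qPoch q) (ℕ.+-suc n m) ⟨
      qPoch q (n ℕ.+ ℕ.suc m)                                 ≈⟨ qPoch-+ n (ℕ.suc m) ⟩
      qPoch q m * (1# - pow q (ℕ.suc m)) * qPochFrom (ℕ.suc m) n ≈⟨ *-assoc _ _ _ ⟩
      qPoch q m * qPochFrom m (ℕ.suc n)                       ∎

    module _ (inv : ℕ → Carrier) (inv-qPoch : ∀ n → qPoch q n * inv n ≈ 1#) where

      qPochFrom-*-inv : ∀ n m → qPochFrom m n * inv (n ℕ.+ m) ≈ inv m
      qPochFrom-*-inv n m = *-inverseʳ-unique (inv-qPoch m) (begin
        qPoch q m * (qPochFrom m n * inv (n ℕ.+ m)) ≈⟨ *-assoc _ _ _ ⟨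
        qPoch q m * qPochFrom m n * inv (n ℕ.+ m)   ≈⟨ *-congʳ (qPoch-+ n m) ⟨
        qPoch q (n ℕ.+ m) * inv (n ℕ.+ m)           ≈⟨ inv-qPoch (n ℕ.+ m) ⟩
        1#                                          ∎)

      Dq^-eq : ∀ a v n m → Dq^ q n (eq q inv a v) m ≈ pow v (C2 n) * pow a n * eq q inv (a * pow v n) v m
      Dq^-eq a v n m = begin
        Dq^ q n (eq q inv a v) m
          ≈⟨ Dq^-coeff (eq q inv a v) n m ⟩
        qPochFrom m n * (pow v (C2 (n ℕ.+ m)) * pow a (n ℕ.+ m) * inv (n ℕ.+ m))
          ≈⟨ x∙yz≈y∙xz _ _ _ ⟩
        pow v (C2 (n ℕ.+ m)) * pow a (n ℕ.+ m) * (qPochFrom m n * inv (n ℕ.+ m))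
          ≈⟨ *-cong (eq-monomial-+ a v n m) (qPochFrom-*-inv n m) ⟩
        pow v (C2 n) * pow a n * (pow v (C2 m) * pow (a * pow v n) m) * inv m
          ≈⟨ *-assoc _ _ _ ⟩
        pow v (C2 n) * pow a n * eq q inv (a * pow v n) v m
          ∎

      T-eq : ∀ a v u →
        T q inv u (eq q inv a v)
          ≋ ySum (λ k → pow (u * v) (C2 k) * pow a k * inv k) (λ k → eq q inv (a * pow v k) v)
      T-eq a v u n m = begin
        pow u (C2 n) * inv n * Dq^ q n (eq q inv a v) m
          ≈⟨ *-congˡ (Dq^-eq a v n m) ⟩
        pow u (C2 n) * inv n * (pow v (C2 n) * pow a n * eq q inv (a * pow v n) v m)
          ≈⟨ solve 5 (λ u₁ i v₁ a₁ e → (u₁ ⊕ i) ⊕ ((v₁ ⊕ a₁) ⊕ e) ⊜ (((u₁ ⊕ v₁) ⊕ a₁) ⊕ i) ⊕ e) refl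
                     (pow u (C2 n)) (inv n) (pow v (C2 n)) (pow a n) (eq q inv (a * pow v n) v m) ⟩
        pow u (C2 n) * pow v (C2 n) * pow a n * inv n * eq q inv (a * pow v n) v m
          ≈⟨ *-congʳ (*-congʳ (*-congʳ (pow-distrib-* u v (C2 n)))) ⟨
        pow (u * v) (C2 n) * pow a n * inv n * eq q inv (a * pow v n) v m
          ∎

-- The hypotheses q ≉ 0 and u ≉ 0 are only needed analytically; the coefficientwise identity holds without them.
mainTheorem7 : ∀ {c ℓ : Level} (R : CommutativeRing c ℓ)
    → let open CommutativeRing R
          open QSeries R
      in
      (q : Carrier) (inv : ℕ → Carrier)
    → ¬ (q ≈ 0#)
    → (∀ n → qPoch q n * inv n ≈ 1#)
    → (a v u : Carrier)
    → ¬ (u ≈ 0#)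
    → T q inv u (eq q inv a v)
        ≋ ySum (λ k → pow (u * v) (C2 k) * pow a k * inv k)
               (λ k → eq q inv (a * pow v k) v)
mainTheorem7 R q inv _ inv-qPoch a v u _ = T-eq R q inv inv-qPoch a v u
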